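{- Let $m,r,n\in\mathbb N$ with $m+r=n$, let $\nu=(\nu_1,\dots,\nu_m)\subseteq R_r=(r^m)$, $\rho=\phi^r(\nu)$ and $\delta:=\mathrm{diag}_0(\nu^\vee)$. Then $$\rho=(\nu_{m-\delta+1}+\delta,\dots,\nu_m+\delta,\nu_1-r+\delta,\dots,\nu_{m-\delta}-r+\delta).$$ Furthermore, $\delta=\mathrm{diag}_0(\rho)$.
   Context: Partitions in French notation (row 1 lowest). $\nu^\vee=(r-\nu_m,\dots,r-\nu_1)$; $\mathrm{diag}_0(\eta)$ is the number of cells of $\eta$ with equal row and column index. The bit string $b_\nu\in\{0,1\}^n$ of $\nu\subseteq R_r$ records the boundary of $\nu$ traced from the upper left corner of $R_r$ to its lower right corner, a vertical step as 0 and a horizontal step as 1 (so it has $m$ zeros and $r$ ones). $\phi^a(\nu)$ is the partition in $R_r$ whose bit string is obtained from $b_\nu$ by moving its first $a$ bits to the end. -}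

module Defs where

open import Data.Nat using (ℕ; zero; suc; _∸_; _≤_; _≤ᵇ_)
open import Data.Nat as ℕ using ()
open import Data.Bool using (Bool; true; false; if_then_else_)
open import Data.List using (List; []; _∷_; _++_; replicate; reverse; map; take; drop)
open import Data.Vec using (Vec; toList; lookup)
open import Data.Fin using (Fin)
import Data.Fin as Fin
open import Data.Integer using (ℤ; +_; _-_) renaming (_+_ to _+ℤ_)

-- A partition ν = (ν₁,…,νₘ) ⊆ R_r = (r^m): m parts (zeros allowed),
-- weakly decreasing, ν₁ ≤ r.  Stored as a Vec with index 0 holding ν₁.
IsPartitionIn : (m r : ℕ) → Vec ℕ m → Set
IsPartitionIn m r ν =
  ((i j : Fin m) → i Fin.≤ j → lookup ν j ≤ lookup ν i) ×' ((i : Fin m) → lookup ν i ≤ r)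
  where
  open import Data.Product using () renaming (_×_ to _×'_)

-- Bit string of ν ⊆ R_r: boundary traced from the upper-left corner of R_r
-- (French notation, row 1 lowest) to the lower-right corner;
-- horizontal step = 1 (true), vertical step = 0 (false).
-- Starting at the top row m, the path goes right ν_m, down, right ν_{m-1}-ν_m,
-- down, …, down, right r-ν_1.
bitsGo : ℕ → ℕ → List ℕ → List Bool
bitsGo r c []       = replicate (r ∸ c) true
bitsGo r c (x ∷ xs) = replicate (x ∸ c) true ++ (false ∷ bitsGo r x xs)

-- input: parts listed ν₁ first
bits : ℕ → List ℕ → List Bool
bits r ν = bitsGo r 0 (reverse ν)

-- Inverse: read the partition off a bit string.  Each 0 (vertical step) gives a
-- part equal to the number of 1s before it; the parts come out top row first,
-- so we reverse to list ν₁ first.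
partGo : ℕ → List Bool → List ℕ
partGo c []           = []
partGo c (true ∷ bs)  = partGo (suc c) bs
partGo c (false ∷ bs) = c ∷ partGo c bs

fromBits : List Bool → List ℕ
fromBits bs = reverse (partGo 0 bs)

rotate : {A : Set} → ℕ → List A → List A
rotate a xs = drop a xs ++ take a xs

φ^ : ℕ → ℕ → List ℕ → List ℕ
φ^ a r ν = fromBits (rotate a (bits r ν))

dual : ℕ → List ℕ → List ℕ
dual r ν = reverse (map (r ∸_) ν)

-- diag₀(η) = #{ i ≥ 1 : η_i ≥ i }  (cells (i,i) of η); parts listed η₁ first
diagGo : ℕ → List ℕ → ℕ
diagGo k []       = 0
diagGo k (x ∷ xs) = (if k ≤ᵇ x then 1 else 0) ℕ.+ diagGo (suc k) xs

diag₀ : List ℕ → ℕ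
diag₀ = diagGo 1

formula : (m r δ : ℕ) → List ℕ → List ℤ
formula m r δ ν =
  map (λ x → (+ x) +ℤ (+ δ)) (drop (m ∸ δ) ν)
  ++ map (λ x → ((+ x) - (+ r)) +ℤ (+ δ)) (take (m ∸ δ) ν)

toℤs : List ℕ → List ℤ
toℤs = map +_

module Submission where

-- List the parts of ν ⊆ R_r from the top row down,
-- L = (ν_m ≤ … ≤ ν_1).  Its boundary word is 1^{L₁} 0 1^{L₂-L₁} 0 … 0 1^{r-L_m},
-- and we cut it after its first r letters: b_ν = P Q.  The 0 recording the
-- k-th part from the top lies among the first r letters iff L_k + k ≤ r, i.e.
-- iff the k-th part of ν^∨ reaches the diagonal; as L ascends, these are
-- exactly the top δ = diag₀(ν^∨) parts.  So P decodes to these top parts A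
-- (and has r - δ ones), while Q decodes to the remaining m - δ parts shifted
-- right by r - δ (and has δ ones).  The rotation φ^r(ν) has word Q P, which
-- decodes to the lower parts shifted left by r - δ followed by A shifted
-- right by δ: this is the formula.  In that partition the δ parts A + δ
-- reach the diagonal and the others (all ≤ δ) do not, so diag₀(φ^r(ν)) = δ.

open import Defs
open import Data.Nat using (ℕ; _+_)
open import Data.Vec using (Vec; toList)
open import Data.Product using (_×_)
open import Relation.Binary.PropositionalEquality using (_≡_)

open import Data.Nat using (zero; suc; _∸_; _≤_; _<_; _≤ᵇ_; _≤?_; z≤n; s≤s; s≤s⁻¹)
open import Data.Nat.Properties
import Data.Nat.Tactic.RingSolver as ℕ-Solver
open import Data.Bool using (Bool; true; false; T; if_then_else_)
open import Data.Unit using (⊤; tt)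
open import Data.Product using (_,_)
open import Data.Vec using ([]; _∷_)
open import Data.Vec.Properties using (length-toList)
open import Data.Fin using () renaming (zero to fzero; suc to fsuc)
open import Data.List using (List; []; _∷_; _++_; [_]; replicate; reverse; map; take; drop; length)
open import Data.List.Properties
  using (++-assoc; length-++; length-replicate; length-reverse; length-map; map-++; map-∘; map-cong;
         reverse-++; reverse-map; reverse-involutive; unfold-reverse)
open import Data.List.Relation.Unary.All as All using (All; []; _∷_)
open import Data.List.Relation.Binary.Permutation.Propositional using (↭-sym)
open import Data.List.Relation.Binary.Permutation.Propositional.Properties using (All-resp-↭; ↭-reverse)
open import Data.Integer using (ℤ; _-_) renaming (+_ to pos; _+_ to _+ℤ_)
open import Data.Integer.Properties using (pos-+)
import Data.Integer.Tactic.RingSolver as ℤ-Solver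
open import Relation.Binary.PropositionalEquality using (refl; sym; trans; cong; cong₂; subst; module ≡-Reasoning)
open import Relation.Nullary using (yes; no; contradiction)
open ≡-Reasoning

replicate-+ : ∀ {A : Set} a b (y : A) → replicate (a + b) y ≡ replicate a y ++ replicate b y
replicate-+ zero    b y = refl
replicate-+ (suc a) b y = cong (y ∷_) (replicate-+ a b y)

drop-prefix : ∀ {A : Set} {k} (xs ys : List A) → length xs ≡ k → drop k (xs ++ ys) ≡ ys
drop-prefix []       ys refl = refl
drop-prefix (x ∷ xs) ys refl = drop-prefix xs ys refl

take-prefix : ∀ {A : Set} {k} (xs ys : List A) → length xs ≡ k → take k (xs ++ ys) ≡ xs
take-prefix []       ys refl = refl
take-prefix (x ∷ xs) ys refl = cong (x ∷_) (take-prefix xs ys refl)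

∸-split : ∀ {r} c t → c + t ≤ r → r ∸ c ≡ r ∸ (c + t) + t
∸-split {r} c t c+t≤r = begin
    r ∸ c            ≡⟨ sym (m∸n+n≡m t≤r∸c) ⟩
    r ∸ c ∸ t + t    ≡⟨ cong (_+ t) (∸-+-assoc r c t) ⟩
    r ∸ (c + t) + t  ∎
  where
  t≤r∸c : t ≤ r ∸ c
  t≤r∸c = m+n≤o⇒m≤o∸n t (subst (_≤ r) (+-comm c t) c+t≤r)

ones : List Bool → ℕ
ones []           = 0
ones (true ∷ bs)  = suc (ones bs)
ones (false ∷ bs) = ones bs

ones-++ : ∀ xs ys → ones (xs ++ ys) ≡ ones xs + ones ys
ones-++ []           ys = refl
ones-++ (true ∷ xs)  ys = cong suc (ones-++ xs ys)
ones-++ (false ∷ xs) ys = ones-++ xs ys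

ones-replicate : ∀ k → ones (replicate k true) ≡ k
ones-replicate zero    = refl
ones-replicate (suc k) = cong suc (ones-replicate k)

partGo-replicate : ∀ k e → partGo e (replicate k true) ≡ []
partGo-replicate zero    e = refl
partGo-replicate (suc k) e = partGo-replicate k (suc e)

partGo-++ : ∀ e xs ys → partGo e (xs ++ ys) ≡ partGo e xs ++ partGo (ones xs + e) ys
partGo-++ e []           ys = refl
partGo-++ e (true ∷ xs)  ys =
  trans (partGo-++ (suc e) xs ys) (cong (λ f → partGo (suc e) xs ++ partGo f ys) (+-suc (ones xs) e))
partGo-++ e (false ∷ xs) ys = cong (e ∷_) (partGo-++ e xs ys)

partGo-shift : ∀ e k bs → partGo (e + k) bs ≡ map (_+ k) (partGo e bs)
partGo-shift e k []           = refl
partGo-shift e k (true ∷ bs)  = partGo-shift (suc e) k bs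
partGo-shift e k (false ∷ bs) = cong ((e + k) ∷_) (partGo-shift e k bs)

-- Every letter is either a part (0) or a column step (1).
length-partGo : ∀ e bs → length (partGo e bs) + ones bs ≡ length bs
length-partGo e []           = refl
length-partGo e (true ∷ bs)  = trans (+-suc _ _) (cong suc (length-partGo (suc e) bs))
length-partGo e (false ∷ bs) = cong suc (length-partGo e bs)

partGo-bounded : ∀ e bs → All (_≤ e + ones bs) (partGo e bs)
partGo-bounded e []           = []
partGo-bounded e (true ∷ bs)  =
  subst (λ f → All (_≤ f) (partGo (suc e) bs)) (sym (+-suc e (ones bs))) (partGo-bounded (suc e) bs)
partGo-bounded e (false ∷ bs) = m≤m+n e (ones bs) ∷ partGo-bounded e bs

decode-step : ∀ {c x} k bs → k + c ≡ x → partGo c (replicate k true ++ false ∷ bs) ≡ x ∷ partGo x bs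
decode-step {c} k bs refl = begin
    partGo c (replicate k true ++ false ∷ bs)
  ≡⟨ partGo-++ c (replicate k true) (false ∷ bs) ⟩
    partGo c (replicate k true) ++ partGo (ones (replicate k true) + c) (false ∷ bs)
  ≡⟨ cong₂ (λ xs e → xs ++ partGo e (false ∷ bs)) (partGo-replicate k c) (cong (_+ c) (ones-replicate k)) ⟩
    partGo (k + c) (false ∷ bs)
  ∎

ones-step : ∀ {c x} k bs → k + c ≡ x → c + ones (replicate k true ++ false ∷ bs) ≡ x + ones bs
ones-step {c} k bs refl = begin
    c + ones (replicate k true ++ false ∷ bs)  ≡⟨ cong (c +_) (ones-++ (replicate k true) (false ∷ bs)) ⟩
    c + (ones (replicate k true) + ones bs)    ≡⟨ cong (λ j → c + (j + ones bs)) (ones-replicate k) ⟩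
    c + (k + ones bs)                          ≡⟨ sym (+-assoc c k (ones bs)) ⟩
    c + k + ones bs                            ≡⟨ cong (_+ ones bs) (+-comm c k) ⟩
    k + c + ones bs                            ∎

-- The parts of a partition in R_r listed top row first, all at least c:
-- c ≤ x₁ ≤ x₂ ≤ … ≤ r.
Ascending : ℕ → ℕ → List ℕ → Set
Ascending r c []       = ⊤
Ascending r c (x ∷ xs) = c ≤ x × x ≤ r × Ascending r x xs

decode-encode : ∀ r c L → Ascending r c L → partGo c (bitsGo r c L) ≡ L
decode-encode r c []       _                 = partGo-replicate (r ∸ c) c
decode-encode r c (x ∷ xs) (c≤x , _ , asc) =
  trans (decode-step (x ∸ c) (bitsGo r x xs) (m∸n+n≡m c≤x)) (cong (x ∷_) (decode-encode r x xs asc))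

ones-encode : ∀ r c L → Ascending r c L → c ≤ r → c + ones (bitsGo r c L) ≡ r
ones-encode r c []       _                   c≤r = trans (cong (c +_) (ones-replicate (r ∸ c))) (m+[n∸m]≡n c≤r)
ones-encode r c (x ∷ xs) (c≤x , x≤r , asc) _   =
  trans (ones-step (x ∸ c) (bitsGo r x xs) (m∸n+n≡m c≤x)) (ones-encode r x xs asc x≤r)

ascending-snoc : ∀ {b x c} ys → Ascending x c ys → c ≤ x → x ≤ b → Ascending b c (ys ++ [ x ])
ascending-snoc []       _                 c≤x x≤b = c≤x , x≤b , tt
ascending-snoc (y ∷ ys) (c≤y , y≤x , asc) c≤x x≤b = c≤y , ≤-trans y≤x x≤b , ascending-snoc ys asc y≤x x≤b

partition-ascending : ∀ {k b} (v : Vec ℕ k) → IsPartitionIn k b v → Ascending b 0 (reverse (toList v))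
partition-ascending         []      _                        = tt
partition-ascending {suc k} {b} (x ∷ v) (decreasing , bounded) =
  subst (Ascending b 0) (sym (unfold-reverse x (toList v)))
    (ascending-snoc (reverse (toList v)) (partition-ascending v tail-partition) z≤n (bounded fzero))
  where
  tail-partition : IsPartitionIn k x v
  tail-partition = (λ i j i≤j → decreasing (fsuc i) (fsuc j) (s≤s i≤j)) , (λ i → decreasing fzero (fsuc i) z≤n)

diagGo-hit : ∀ {k x} xs → k ≤ x → diagGo k (x ∷ xs) ≡ suc (diagGo (suc k) xs)
diagGo-hit {k} {x} xs k≤x with k ≤ᵇ x | ≤⇒≤ᵇ k≤x
... | true  | _  = refl
... | false | ()

diagGo-miss : ∀ {k x} xs → x < k → diagGo k (x ∷ xs) ≡ diagGo (suc k) xs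
diagGo-miss {k} {x} xs x<k with k ≤ᵇ x in k≤ᵇx
... | false = refl
... | true  = contradiction (≤ᵇ⇒≤ k x (subst T (sym k≤ᵇx) tt)) (<⇒≱ x<k)

diagGo-++ : ∀ k xs ys → diagGo k (xs ++ ys) ≡ diagGo k xs + diagGo (length xs + k) ys
diagGo-++ k []       ys = refl
diagGo-++ k (x ∷ xs) ys = begin
    hit + diagGo (suc k) (xs ++ ys)
  ≡⟨ cong (hit +_) (diagGo-++ (suc k) xs ys) ⟩
    hit + (diagGo (suc k) xs + diagGo (length xs + suc k) ys)
  ≡⟨ cong (λ j → hit + (diagGo (suc k) xs + diagGo j ys)) (+-suc (length xs) k) ⟩
    hit + (diagGo (suc k) xs + diagGo (suc (length xs + k)) ys)
  ≡⟨ sym (+-assoc hit _ _) ⟩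
    hit + diagGo (suc k) xs + diagGo (suc (length xs + k)) ys
  ∎
  where
  hit : ℕ
  hit = if k ≤ᵇ x then 1 else 0

diagGo-shifted : ∀ d k Z → k + length Z ≤ suc d → diagGo k (map (_+ d) Z) ≡ length Z
diagGo-shifted d k []      _  = refl
diagGo-shifted d k (z ∷ Z) le = trans (diagGo-hit (map (_+ d) Z) k≤z+d) (cong suc (diagGo-shifted d (suc k) Z le′))
  where
  le′ : suc (k + length Z) ≤ suc d
  le′ = subst (_≤ suc d) (+-suc k (length Z)) le
  k≤z+d : k ≤ z + d
  k≤z+d = ≤-trans (m+n≤o⇒m≤o k (s≤s⁻¹ le′)) (m≤n+m d z)

diagGo-vanishes : ∀ d k Z → All (_≤ d) Z → d < k → diagGo k Z ≡ 0
diagGo-vanishes d k []      _             _   = refl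
diagGo-vanishes d k (z ∷ Z) (z≤d ∷ Z≤d) d<k =
  trans (diagGo-miss Z (≤-<-trans z≤d d<k)) (diagGo-vanishes d (suc k) Z Z≤d (m<n⇒m<1+n d<k))

dual-bounded : ∀ r c L → Ascending r c L → All (_≤ r ∸ c) (map (r ∸_) L)
dual-bounded r c []       _                 = []
dual-bounded r c (x ∷ xs) (c≤x , _ , asc) =
  ∸-monoʳ-≤ r c≤x ∷ All.map (λ le → ≤-trans le (∸-monoʳ-≤ r c≤x)) (dual-bounded r x xs asc)

-- A cut of the boundary word of L, read from column c with t rows of the
-- dual already counted: L = A ++ B and its word is P ++ Q, where P has
-- exactly r ∸ (c + t) letters and decodes to A, Q decodes to B from the
-- column P ends at, and the dual of L has |A| diagonal cells from row t + 1.
record Cut (r c t : ℕ) (L : List ℕ) : Set where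
  field
    A B       : List ℕ
    P Q       : List Bool
    L≡A++B    : L ≡ A ++ B
    word≡P++Q : bitsGo r c L ≡ P ++ Q
    length-P  : length P + (c + t) ≡ r
    P-decodes : partGo c P ≡ A
    Q-decodes : partGo (c + ones P) Q ≡ B
    diag-A    : diagGo (suc t) (map (r ∸_) L) ≡ length A

-- No rows left: the cut falls inside the final run of 1s.
cut-[] : ∀ {r c t} → c + t ≤ r → Cut r c t []
cut-[] {r} {c} {t} c+t≤r = record
  { A = [] ; B = [] ; P = replicate a true ; Q = replicate t true
  ; L≡A++B    = refl
  ; word≡P++Q = trans (cong (λ k → replicate k true) (∸-split c t c+t≤r)) (replicate-+ a t true)
  ; length-P  = trans (cong (_+ (c + t)) (length-replicate a)) (m∸n+n≡m c+t≤r)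
  ; P-decodes = partGo-replicate a c
  ; Q-decodes = partGo-replicate t (c + ones (replicate a true))
  ; diag-A    = refl
  }
  where
  a : ℕ
  a = r ∸ (c + t)

-- The next part x has r ≤ x + t, so its dual part misses the diagonal: the
-- cut falls inside the run of 1s before its 0, A is empty, and no later
-- dual part reaches the diagonal either.
cut-stop : ∀ {r c t x xs} → Ascending r c (x ∷ xs) → c + t ≤ r → r ≤ x + t → Cut r c t (x ∷ xs)
cut-stop {r} {c} {t} {x} {xs} (c≤x , x≤r , asc) c+t≤r r≤x+t = record
  { A = [] ; B = x ∷ xs ; P = replicate a true ; Q = replicate b true ++ rest
  ; L≡A++B    = refl
  ; word≡P++Q = begin
      replicate (x ∸ c) true ++ rest
    ≡⟨ cong (λ k → replicate k true ++ rest) x∸c≡a+b ⟩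
      replicate (a + b) true ++ rest
    ≡⟨ cong (_++ rest) (replicate-+ a b true) ⟩
      (replicate a true ++ replicate b true) ++ rest
    ≡⟨ ++-assoc (replicate a true) (replicate b true) rest ⟩
      replicate a true ++ replicate b true ++ rest
    ∎
  ; length-P  = trans (cong (_+ (c + t)) (length-replicate a)) (m∸n+n≡m c+t≤r)
  ; P-decodes = partGo-replicate a c
  ; Q-decodes = begin
      partGo (c + ones (replicate a true)) (replicate b true ++ rest)
    ≡⟨ cong (λ e → partGo (c + e) (replicate b true ++ rest)) (ones-replicate a) ⟩
      partGo (c + a) (replicate b true ++ rest)
    ≡⟨ decode-step b (bitsGo r x xs) (m∸n+n≡m c+a≤x) ⟩
      x ∷ partGo x (bitsGo r x xs)
    ≡⟨ cong (x ∷_) (decode-encode r x xs asc) ⟩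
      x ∷ xs
    ∎
  ; diag-A    = diagGo-vanishes (r ∸ x) (suc t) (map (r ∸_) (x ∷ xs))
                  (dual-bounded r x (x ∷ xs) (≤-refl , x≤r , asc)) (s≤s (m≤n+o⇒m∸n≤o r x r≤x+t))
  }
  where
  a : ℕ
  a = r ∸ (c + t)
  rest : List Bool
  rest = false ∷ bitsGo r x xs
  c+a+t≡r : c + a + t ≡ r
  c+a+t≡r = trans (cong (_+ t) (+-comm c a)) (trans (+-assoc a c t) (m∸n+n≡m c+t≤r))
  c+a≤x : c + a ≤ x
  c+a≤x = +-cancelʳ-≤ t (c + a) x (subst (_≤ x + t) (sym c+a+t≡r) r≤x+t)
  b : ℕ
  b = x ∸ (c + a)
  x∸c≡a+b : x ∸ c ≡ a + b
  x∸c≡a+b = trans (∸-split c a c+a≤x) (+-comm b a)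

-- The next part x has x + t + 1 ≤ r, so its dual part reaches the diagonal
-- and its 0 lies before the cut: x joins A.
cut-extend : ∀ {r c t x xs} → c ≤ x → x + suc t ≤ r → Cut r x (suc t) xs → Cut r c t (x ∷ xs)
cut-extend {r} {c} {t} {x} {xs} c≤x x+t<r C = record
  { A = x ∷ A ; B = B ; P = replicate u true ++ false ∷ P ; Q = Q
  ; L≡A++B    = cong (x ∷_) L≡A++B
  ; word≡P++Q = trans (cong (λ w → replicate u true ++ false ∷ w) word≡P++Q)
                      (sym (++-assoc (replicate u true) (false ∷ P) Q))
  ; length-P  = begin
      length (replicate u true ++ false ∷ P) + (c + t)
    ≡⟨ cong (_+ (c + t)) (trans (length-++ (replicate u true)) (cong (_+ suc (length P)) (length-replicate u))) ⟩
      u + suc (length P) + (c + t)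
    ≡⟨ regroup u c (length P) t ⟩
      length P + (u + c + suc t)
    ≡⟨ cong (λ y → length P + (y + suc t)) u+c≡x ⟩
      length P + (x + suc t)
    ≡⟨ length-P ⟩
      r
    ∎
  ; P-decodes = trans (decode-step u P u+c≡x) (cong (x ∷_) P-decodes)
  ; Q-decodes = trans (cong (λ e → partGo e Q) (ones-step u P u+c≡x)) Q-decodes
  ; diag-A    = trans (diagGo-hit (map (r ∸_) xs) t<r∸x) (cong suc diag-A)
  }
  where
  open Cut C
  u : ℕ
  u = x ∸ c
  u+c≡x : u + c ≡ x
  u+c≡x = m∸n+n≡m c≤x
  t<r∸x : suc t ≤ r ∸ x
  t<r∸x = m+n≤o⇒m≤o∸n (suc t) (subst (_≤ r) (+-comm x (suc t)) x+t<r)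
  regroup : ∀ u c p t → u + suc p + (c + t) ≡ p + (u + c + suc t)
  regroup = ℕ-Solver.solve-∀

cut : ∀ r c t L → Ascending r c L → c + t ≤ r → Cut r c t L
cut r c t []       _                          c+t≤r = cut-[] c+t≤r
cut r c t (x ∷ xs) asc@(c≤x , x≤r , asc-xs) c+t≤r with x + suc t ≤? r
... | yes x+t<r = cut-extend c≤x x+t<r (cut r x (suc t) xs asc-xs x+t<r)
... | no  x+t≮r = cut-stop asc c+t≤r (s≤s⁻¹ (subst (suc r ≤_) (+-suc x t) (≰⇒> x+t≮r)))

-- With δ = |A| and p = r - δ: ν lists (top row first) the δ parts A, then
-- the parts B₀ shifted right by p; φ^r(ν) lists B₀, then A shifted right by δ.
record RotationShape (r : ℕ) (l : List ℕ) : Set where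
  field
    A B₀       : List ℕ
    p          : ℕ
    p+δ≡r      : p + length A ≡ r
    B₀-bounded : All (_≤ length A) B₀
    l-shape    : l ≡ reverse (map (_+ p) B₀) ++ reverse A
    φ-shape    : φ^ r r l ≡ reverse (B₀ ++ map (_+ length A) A)
    dual-diag  : diag₀ (dual r l) ≡ length A

-- Cutting the boundary word after its first r letters gives the shape.
rotation-shape : ∀ r l → Ascending r 0 (reverse l) → RotationShape r l
rotation-shape r l asc = record
  { A = A ; B₀ = B₀ ; p = ones P
  ; p+δ≡r      = p+δ≡r
  ; B₀-bounded = subst (λ k → All (_≤ k) B₀) ones-Q (partGo-bounded 0 Q)
  ; l-shape    = begin
      l                                        ≡⟨ sym (reverse-involutive l) ⟩
      reverse (reverse l)                      ≡⟨ cong reverse L≡A++B ⟩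
      reverse (A ++ B)                         ≡⟨ reverse-++ A B ⟩
      reverse B ++ reverse A                   ≡⟨ cong (λ X → reverse X ++ reverse A) B-shifted ⟩
      reverse (map (_+ ones P) B₀) ++ reverse A ∎
  ; φ-shape    = begin
      reverse (partGo 0 (rotate r (bits r l)))
    ≡⟨ cong (λ w → reverse (partGo 0 w)) rotated ⟩
      reverse (partGo 0 (Q ++ P))
    ≡⟨ cong reverse (partGo-++ 0 Q P) ⟩
      reverse (B₀ ++ partGo (ones Q + 0) P)
    ≡⟨ cong (λ e → reverse (B₀ ++ partGo e P)) (trans (+-identityʳ (ones Q)) ones-Q) ⟩
      reverse (B₀ ++ partGo (0 + length A) P)
    ≡⟨ cong (λ X → reverse (B₀ ++ X)) (trans (partGo-shift 0 (length A) P) (cong (map (_+ length A)) P-decodes)) ⟩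
      reverse (B₀ ++ map (_+ length A) A)
    ∎
  ; dual-diag  = trans (cong (diagGo 1) (sym (reverse-map (r ∸_) l))) diag-A
  }
  where
  open Cut (cut r 0 0 (reverse l) asc z≤n)
  B₀ : List ℕ
  B₀ = partGo 0 Q
  |P|≡r : length P ≡ r
  |P|≡r = trans (sym (+-identityʳ (length P))) length-P
  p+δ≡r : ones P + length A ≡ r
  p+δ≡r = trans (+-comm (ones P) (length A))
            (trans (cong (λ X → length X + ones P) (sym P-decodes)) (trans (length-partGo 0 P) |P|≡r))
  ones-Q : ones Q ≡ length A
  ones-Q = +-cancelˡ-≡ (ones P) (ones Q) (length A)
             (trans (sym (ones-++ P Q))
               (trans (cong ones (sym word≡P++Q)) (trans (ones-encode r 0 (reverse l) asc z≤n) (sym p+δ≡r))))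
  B-shifted : B ≡ map (_+ ones P) B₀
  B-shifted = trans (sym Q-decodes) (partGo-shift 0 (ones P) Q)
  rotated : rotate r (bits r l) ≡ Q ++ P
  rotated = trans (cong (rotate r) word≡P++Q) (cong₂ _++_ (drop-prefix P Q |P|≡r) (take-prefix P Q |P|≡r))

-- Reading the formula off the shape: with p + δ = r, the lower parts come
-- back as B₀ = (part - r + δ) and the top parts as A + δ.
rotated-formula : ∀ {r p} A B₀ l → p + length A ≡ r → l ≡ reverse (map (_+ p) B₀) ++ reverse A →
  toℤs (reverse (B₀ ++ map (_+ length A) A)) ≡ formula (length l) r (length A) l
rotated-formula {r} {p} A B₀ l p+δ≡r refl = begin
    map pos (reverse (B₀ ++ map (_+ d) A))
  ≡⟨ cong (map pos) (reverse-++ B₀ (map (_+ d) A)) ⟩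
    map pos (reverse (map (_+ d) A) ++ reverse B₀)
  ≡⟨ map-++ pos (reverse (map (_+ d) A)) (reverse B₀) ⟩
    map pos (reverse (map (_+ d) A)) ++ map pos (reverse B₀)
  ≡⟨ cong₂ _++_ top-parts lower-parts ⟩
    map raise (reverse A) ++ map lower R
  ≡⟨ sym (cong₂ (λ U V → map raise U ++ map lower V) (drop-prefix R (reverse A) |R|) (take-prefix R (reverse A) |R|)) ⟩
    formula (length (R ++ reverse A)) r d (R ++ reverse A)
  ∎
  where
  d : ℕ
  d = length A
  R : List ℕ
  R = reverse (map (_+ p) B₀)
  raise lower : ℕ → ℤ
  raise x = pos x +ℤ pos d
  lower x = (pos x - pos r) +ℤ pos d
  |R| : length R ≡ length (R ++ reverse A) ∸ d
  |R| = sym (trans (cong (_∸ d) (trans (length-++ R) (cong (length R +_) (length-reverse A)))) (m+n∸n≡m (length R) d))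
  top-parts : map pos (reverse (map (_+ d) A)) ≡ map raise (reverse A)
  top-parts = trans (cong (map pos) (sym (reverse-map (_+ d) A)))
                (trans (sym (map-∘ (reverse A))) (map-cong (λ x → pos-+ x d) (reverse A)))
  cancel : ∀ y p d → ((y +ℤ p) - (p +ℤ d)) +ℤ d ≡ y
  cancel = ℤ-Solver.solve-∀
  lower-shift : ∀ y → lower (y + p) ≡ pos y
  lower-shift y = begin
      (pos (y + p) - pos r) +ℤ pos d                  ≡⟨ cong (λ k → (pos (y + p) - pos k) +ℤ pos d) (sym p+δ≡r) ⟩
      (pos (y + p) - pos (p + d)) +ℤ pos d            ≡⟨ cong₂ (λ u v → (u - v) +ℤ pos d) (pos-+ y p) (pos-+ p d) ⟩
      ((pos y +ℤ pos p) - (pos p +ℤ pos d)) +ℤ pos d  ≡⟨ cancel (pos y) (pos p) (pos d) ⟩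
      pos y                                           ∎
  lower-parts : map pos (reverse B₀) ≡ map lower R
  lower-parts = trans (map-cong (λ y → sym (lower-shift y)) (reverse B₀))
                  (trans (map-∘ (reverse B₀)) (cong (map lower) (reverse-map (_+ p) B₀)))

-- In the partition whose rows, bottom row first, are A + δ and then B₀,
-- exactly the δ parts of A + δ reach the diagonal, as all of B₀ is at most δ.
rotated-diag : ∀ A B₀ → All (_≤ length A) B₀ → diag₀ (reverse (B₀ ++ map (_+ length A) A)) ≡ length A
rotated-diag A B₀ B₀≤d = begin
    diagGo 1 (reverse (B₀ ++ map (_+ d) A))
  ≡⟨ cong (diagGo 1) (reverse-++ B₀ (map (_+ d) A)) ⟩
    diagGo 1 (reverse (map (_+ d) A) ++ reverse B₀)
  ≡⟨ diagGo-++ 1 (reverse (map (_+ d) A)) (reverse B₀) ⟩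
    diagGo 1 (reverse (map (_+ d) A)) + diagGo (length (reverse (map (_+ d) A)) + 1) (reverse B₀)
  ≡⟨ cong₂ _+_ top-hits lower-misses ⟩
    d + 0
  ≡⟨ +-identityʳ d ⟩
    d
  ∎
  where
  d : ℕ
  d = length A
  top-hits : diagGo 1 (reverse (map (_+ d) A)) ≡ d
  top-hits = trans (cong (diagGo 1) (sym (reverse-map (_+ d) A)))
               (trans (diagGo-shifted d 1 (reverse A) (s≤s (≤-reflexive (length-reverse A)))) (length-reverse A))
  d<rows : d < length (reverse (map (_+ d) A)) + 1
  d<rows = subst (λ k → d < k + 1) (sym (trans (length-reverse (map (_+ d) A)) (length-map (_+ d) A)))
             (m<m+n d (s≤s z≤n))
  lower-misses : diagGo (length (reverse (map (_+ d) A)) + 1) (reverse B₀) ≡ 0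
  lower-misses = diagGo-vanishes d _ (reverse B₀) (All-resp-↭ (↭-sym (↭-reverse B₀)) B₀≤d) d<rows

lemma5p3 : (m r n : ℕ) → m + r ≡ n → (ν : Vec ℕ m) → IsPartitionIn m r ν →
    toℤs (φ^ r r (toList ν)) ≡ formula m r (diag₀ (dual r (toList ν))) (toList ν)
    × diag₀ (dual r (toList ν)) ≡ diag₀ (φ^ r r (toList ν))
lemma5p3 m r _ _ ν isPartition = formula-holds , diag-holds
  where
  l : List ℕ
  l = toList ν
  open RotationShape (rotation-shape r l (partition-ascending ν isPartition))
  formula-holds : toℤs (φ^ r r l) ≡ formula m r (diag₀ (dual r l)) l
  formula-holds = begin
      toℤs (φ^ r r l)                              ≡⟨ cong toℤs φ-shape ⟩
      toℤs (reverse (B₀ ++ map (_+ length A) A))   ≡⟨ rotated-formula A B₀ l p+δ≡r l-shape ⟩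
      formula (length l) r (length A) l            ≡⟨ cong₂ (λ k δ → formula k r δ l) (length-toList ν) (sym dual-diag) ⟩
      formula m r (diag₀ (dual r l)) l             ∎
  diag-holds : diag₀ (dual r l) ≡ diag₀ (φ^ r r l)
  diag-holds = begin
      diag₀ (dual r l)                             ≡⟨ dual-diag ⟩
      length A                                     ≡⟨ sym (rotated-diag A B₀ B₀-bounded) ⟩
      diag₀ (reverse (B₀ ++ map (_+ length A) A))  ≡⟨ cong diag₀ (sym φ-shape) ⟩
      diag₀ (φ^ r r l)                             ∎
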